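{- Let $C\geq 3$ and $k\in\{1,\dots,C-1\}$ be integers, and let $S$ be a minimum $k$-power dominating set of $WKP_{(C,2)}$ (i.e. a $k$-PDS with $|S|=\gamma_{P,k}(WKP_{(C,2)})$). Then $S$ contains at least one vertex at level $1$.
   Context: For a graph $G$, $S\subseteq V(G)$ and an integer $k\ge 0$, define $\mathcal{P}^0_{G,k}(S)=N_G[S]$ (closed neighbourhood of $S$) and $\mathcal{P}^{i+1}_{G,k}(S)=\bigcup\{N_G[v] : v\in \mathcal{P}^i_{G,k}(S),\ |N_G[v]\setminus \mathcal{P}^i_{G,k}(S)|\le k\}$. These sets increase and stabilize at a set $\mathcal{P}^\infty_{G,k}(S)$. A $k$-power dominating set ($k$-PDS) is a set $S$ with $\mathcal{P}^\infty_{G,k}(S)=V(G)$, and $\gamma_{P,k}(G)$ is the minimum cardinality of a $k$-PDS of $G$. Let $[C]_0=\{0,\dots,C-1\}$. The WK-Pyramid network $WKP_{(C,L)}$ has vertex set $\{(r,(a_r a_{r-1}\cdots a_1)) : r\in\{1,\dots,L\},\ a_i\in[C]_0\}\cup\{(0,(1))\}$; a vertex $(r,(a_r\cdots a_1))$ is said to be at level $r$. The vertex $(0,(1))$ is adjacent to every vertex at level $1$. A vertex $(r,(a_r\cdots a_1))$ with $r>0$ is adjacent to: (1) the vertices $(r,(a_r\cdots a_2 b))$ with $b\in[C]_0$, $b\ne a_1$; (2) the vertex $(r,(a_r\cdots a_{j+1}a_{j-1}(a_j)^{j-1}))$ if there is a $j$ with $2\le j\le r$, $a_{j-1}=a_{j-2}=\cdots=a_1$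 and $a_j\ne a_{j-1}$, where $(a_j)^{j-1}$ denotes $a_j$ repeated $j-1$ times; (3) the vertices $(r+1,(a_r\cdots a_1 b))$ for $b\in[C]_0$ (when $r<L$); (4) the vertex $(r-1,(a_r\cdots a_2))$ (for $r=1$ this is $(0,(1))$). In $WKP_{(C,2)}$ the level-$1$ vertices are $(1,(i))$, $i\in[C]_0$. -}

module Defs where

open import Data.Nat using (ℕ; zero; suc; _≤_)
open import Data.Fin using (Fin)
open import Data.List using (List; []; _∷_; length; replicate; _++_)
open import Data.List.Membership.Propositional using (_∈_)
open import Data.Product using (Σ; ∃; _×_; _,_; proj₁)
open import Data.Sum using (_⊎_)
open import Relation.Binary.PropositionalEquality using (_≡_; _≢_)
open import Relation.Nullary using (¬_)

-- A vertex (r,(a_r ... a_1)) is encoded as the word a_1 ∷ a_2 ∷ ... ∷ a_r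
-- (least significant digit a_1 first), of length r ≤ L.
-- The apex (0,(1)) is the empty word [].

WKPVertex : ℕ → ℕ → Set
WKPVertex C L = Σ (List (Fin C)) (λ w → length w ≤ L)

level : ∀ {C L} → WKPVertex C L → ℕ
level v = length (proj₁ v)

data WKPRule {C : ℕ} : List (Fin C) → List (Fin C) → Set where
  sibling : ∀ {a b t} → a ≢ b → WKPRule (a ∷ t) (b ∷ t)
  -- (2) a_1 = … = a_{j-1} = x, a_j = y ≠ x (j = m+1 ≥ 2):
  --     (r,(rest y x^{m})) ~ (r,(rest x y^{m}))
  swap    : ∀ {m x y rest} → 1 ≤ m → x ≢ y →
            WKPRule (replicate m x ++ (y ∷ rest)) (replicate m y ++ (x ∷ rest))
  -- (3) (r,(a_r…a_1)) ~ (r+1,(a_r…a_1 b))  (also covers apex ~ level 1)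
  child   : ∀ {b w} → WKPRule w (b ∷ w)
  parent  : ∀ {b w} → WKPRule (b ∷ w) w

WKPAdj : ∀ {C L} → WKPVertex C L → WKPVertex C L → Set
WKPAdj u v = WKPRule (proj₁ u) (proj₁ v) ⊎ WKPRule (proj₁ v) (proj₁ u)

module PowerDomination {V : Set} (Adj : V → V → Set) where

  N[_] : V → V → Set
  N[ v ] u = u ≡ v ⊎ Adj v u

  N[S] : List V → V → Set
  N[S] S u = ∃ λ s → s ∈ S × N[ s ] u

  AtMost : ℕ → (V → Set) → Set
  AtMost k A = ∃ λ (xs : List V) → length xs ≤ k × (∀ u → A u → u ∈ xs)

  𝒫 : ℕ → List V → ℕ → V → Set
  𝒫 k S zero    u = N[S] S u
  𝒫 k S (suc i) u = ∃ λ v → 𝒫 k S i v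
                    × AtMost k (λ w → N[ v ] w × ¬ 𝒫 k S i w)
                    × N[ v ] u

  𝒫∞ : ℕ → List V → V → Set
  𝒫∞ k S u = ∃ λ i → 𝒫 k S i u

  IsKPDS : ℕ → List V → Set
  IsKPDS k S = ∀ u → 𝒫∞ k S u

  IsMinKPDS : ℕ → List V → Set
  IsMinKPDS k S = IsKPDS k S × (∀ T → IsKPDS k T → length S ≤ length T)

open PowerDomination public

-- Give every vertex a block and a digit in {∗} ∪ [C]₀: the apex has (∗,∗), (1,(a)) has
-- (a,∗) and (2,(a x)) has (a,x).  Call a label hit if it is the block of a vertex of S and
-- a vertex unseen if neither of its labels is hit.  If S has no level-1 vertex, every
-- vertex of N[S] carries a hit label, and an observed vertex with an unseen neighbour has
-- unseen neighbours realising every unhit label.  Forcing would then need them all, so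
-- S and at most k forced vertices would cover all C + 1 labels, impossible when
-- |S| + k ≤ C.  Hence unseen vertices are never observed, and one exists: the vertex
-- labelled (ℓ,ℓ) for a label ℓ that the at most C blocks of S miss.
-- This bound applies to a minimum k-PDS, because the C − k vertices (1,(i)), i < C − k,
-- form a k-PDS: they observe the apex, level 1 and their own blocks, then (2,(i a))
-- forces its swap partner (2,(a i)), and finally each remaining (1,(a)) has only the k
-- children (2,(a j)), j ≥ C − k, unobserved.
module Submission where

open import Defs
open import Data.Nat using (ℕ; zero; suc; _+_; _∸_; _≤_; _<_; z≤n; s≤s; _≤?_; _≟_)
open import Data.Nat.Properties using (+-monoʳ-≤; 1+n≰n; ≰⇒>; ≤-reflexive; +-monoˡ-≤; <⇒≤; m∸n+n≡m; m<n⇒0<n∸m; module ≤-Reasoning)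
open import Data.Fin as Fin using (Fin; zero; suc; fromℕ<; _↑ˡ_; _↑ʳ_; splitAt; join) renaming (_≟_ to _≟ᶠ_)
open import Data.Fin.Properties using (pigeonhole; <⇒≢; any?; splitAt-↑ˡ; splitAt-↑ʳ; join-splitAt)
open import Data.List using (List; []; _∷_; [_]; length; map; lookup; tabulate; _++_)
open import Data.List.Properties using (length-map; length-++; length-tabulate)
open import Data.List.Relation.Unary.Any as Any using (Any; here; index)
open import Data.List.Relation.Unary.Any.Properties using (lookup-index)
open import Data.List.Relation.Unary.Unique.Propositional using (Unique)
open import Data.List.Membership.Propositional using (_∈_; lose; find)
open import Data.List.Membership.Propositional.Properties using (∈-map⁺; ∈-++⁺ˡ; ∈-++⁺ʳ; ∈-tabulate⁺)
import Data.List.Membership.DecPropositional as DecMembership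
open import Data.Product using (∃; ∃₂; _×_; _,_; proj₁)
open import Data.Sum using (_⊎_; inj₁; inj₂)
open import Data.Empty using (⊥-elim)
open import Function using (_∘_)
open import Relation.Nullary using (¬_; Dec; yes; no; ¬?)
open import Relation.Binary.PropositionalEquality using (_≡_; _≢_; refl; sym; trans; cong; cong₂; subst; ≢-sym; module ≡-Reasoning)

covering-length : ∀ {n} (zs : List (Fin n)) → (∀ i → i ∈ zs) → n ≤ length zs
covering-length {n} zs covers with n ≤? length zs
... | yes n≤ = n≤
... | no n≰ = ⊥-elim (distinct-indices (pigeonhole (≰⇒> n≰) (λ i → index (covers i))))
  where
    open ≡-Reasoning
    distinct-indices : ¬ ∃₂ λ i j → i Fin.< j × index (covers i) ≡ index (covers j)
    distinct-indices (i , j , i<j , same) = <⇒≢ i<j (begin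
      i                            ≡⟨ lookup-index (covers i) ⟩
      lookup zs (index (covers i)) ≡⟨ cong (lookup zs) same ⟩
      lookup zs (index (covers j)) ≡⟨ lookup-index (covers j) ⟨
      j                            ∎)

module Forcing {V : Set} (Adj : V → V → Set) {k : ℕ} {S : List V} where

  force : ∀ i {u v} → 𝒫 Adj k S i u → (xs : List V) → length xs ≤ k →
          (∀ w → N[_] Adj u w → ¬ 𝒫 Adj k S i w → w ∈ xs) →
          N[_] Adj u v → 𝒫 Adj k S (suc i) v
  force _ pu xs |xs|≤k forced nb = _ , pu , (xs , |xs|≤k , λ w (nbw , ¬pw) → forced w nbw ¬pw) , nb

  𝒫-suc : ∀ i {v} → 𝒫 Adj k S i v → 𝒫 Adj k S (suc i) v
  𝒫-suc zero (s , s∈S , nb) =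
    force 0 (s , s∈S , inj₁ refl) [] z≤n (λ w nbw ¬pw → ⊥-elim (¬pw (s , s∈S , nbw))) nb
  𝒫-suc (suc i) (u , pu , (xs , |xs|≤k , forced) , nb) =
    force (suc i) (u , pu , (xs , |xs|≤k , forced) , inj₁ refl) xs |xs|≤k
          (λ w nbw ¬pw → forced w (nbw , ¬pw ∘ 𝒫-suc i)) nb

Vertex : ℕ → Set
Vertex C = WKPVertex C 2

apex : ∀ {C} → Vertex C
apex = [] , z≤n

vertex₁ : ∀ {C} → Fin C → Vertex C
vertex₁ a = a ∷ [] , s≤s z≤n

-- the vertex (2,(a x)); words list the least significant digit first
vertex₂ : ∀ {C} → Fin C → Fin C → Vertex C
vertex₂ a x = x ∷ a ∷ [] , s≤s (s≤s z≤n)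

-- On words of length at most 2 rule (2) only occurs with j = 2, so adjacency in
-- WKP(C,2) is the following symmetric relation.
data Adj₂ {C : ℕ} : List (Fin C) → List (Fin C) → Set where
  sibling : ∀ {a b t} → a ≢ b → Adj₂ (a ∷ t) (b ∷ t)
  swap    : ∀ {x y t} → x ≢ y → Adj₂ (x ∷ y ∷ t) (y ∷ x ∷ t)
  child   : ∀ {b w} → Adj₂ w (b ∷ w)
  parent  : ∀ {b w} → Adj₂ (b ∷ w) w

Adj₂-sym : ∀ {C} {w w' : List (Fin C)} → Adj₂ w w' → Adj₂ w' w
Adj₂-sym (sibling a≢b) = sibling (≢-sym a≢b)
Adj₂-sym (swap x≢y)    = swap (≢-sym x≢y)
Adj₂-sym child         = parent
Adj₂-sym parent        = child

WKPRule⇒Adj₂ : ∀ {C} {w w' : List (Fin C)} → length w ≤ 2 → WKPRule w w' → Adj₂ w w'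
WKPRule⇒Adj₂ _              (sibling a≢b)                 = sibling a≢b
WKPRule⇒Adj₂ _              (swap {m = 1} _ x≢y)          = swap x≢y
WKPRule⇒Adj₂ (s≤s (s≤s ())) (swap {m = 2} _ _)
WKPRule⇒Adj₂ (s≤s (s≤s ())) (swap {m = suc (suc (suc _))} _ _)
WKPRule⇒Adj₂ _              child                         = child
WKPRule⇒Adj₂ _              parent                        = parent

Adj₂⇒WKPRule : ∀ {C} {w w' : List (Fin C)} → Adj₂ w w' → WKPRule w w'
Adj₂⇒WKPRule (sibling a≢b) = sibling a≢b
Adj₂⇒WKPRule (swap x≢y)    = swap {m = 1} (s≤s z≤n) x≢y
Adj₂⇒WKPRule child         = child
Adj₂⇒WKPRule parent        = parent

_∈N[_] : ∀ {C} → Vertex C → Vertex C → Set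
v ∈N[ u ] = N[_] WKPAdj u v

adjacent : ∀ {C} {u v : Vertex C} → Adj₂ (proj₁ u) (proj₁ v) → v ∈N[ u ]
adjacent a = inj₂ (inj₁ (Adj₂⇒WKPRule a))

data Neighbour {C : ℕ} (u : Vertex C) : Vertex C → Set where
  self : Neighbour u u
  adj  : ∀ {w p} → Adj₂ (proj₁ u) w → Neighbour u (w , p)

neighbour : ∀ {C} {u v : Vertex C} → v ∈N[ u ] → Neighbour u v
neighbour (inj₁ refl)                   = self
neighbour {u = _ , ℓu} (inj₂ (inj₁ r)) = adj (WKPRule⇒Adj₂ ℓu r)
neighbour {v = _ , ℓv} (inj₂ (inj₂ r)) = adj (Adj₂-sym (WKPRule⇒Adj₂ ℓv r))

module LowerBound {C : ℕ} (k : ℕ) (S : List (Vertex C)) where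

  -- zero plays the role of ∗
  Label : Set
  Label = Fin (suc C)

  block : Vertex C → Label
  block ([] , _)          = zero
  block (a ∷ [] , _)      = suc a
  block (_ ∷ a ∷ _ , _)   = suc a

  digit : Vertex C → Label
  digit ([] , _)          = zero
  digit (_ ∷ [] , _)      = zero
  digit (x ∷ _ ∷ _ , _)   = suc x

  Hit : Label → Set
  Hit ℓ = ℓ ∈ map block S

  hit? : ∀ ℓ → Dec (Hit ℓ)
  hit? ℓ = DecMembership._∈?_ _≟ᶠ_ ℓ (map block S)

  Unseen : Vertex C → Set
  Unseen v = ¬ Hit (block v) × ¬ Hit (digit v)

  carries-hit : ∀ {ℓ} v → Hit ℓ → block v ≡ ℓ ⊎ digit v ≡ ℓ → ¬ Unseen v
  carries-hit _ h (inj₁ refl) (¬hb , _) = ¬hb h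
  carries-hit _ h (inj₂ refl) (_ , ¬hd) = ¬hd h

  neighbour-shares-block : ∀ {s v} → level s ≢ 1 → v ∈N[ s ] →
                           block v ≡ block s ⊎ digit v ≡ block s
  neighbour-shares-block {[] , _} _ nb with neighbour nb
  ... | self      = inj₁ refl
  ... | adj child = inj₂ refl
  neighbour-shares-block {_ ∷ [] , _} ≢1 _ = ⊥-elim (≢1 refl)
  neighbour-shares-block {_ ∷ _ ∷ [] , _} _ nb with neighbour nb
  ... | self                          = inj₁ refl
  ... | adj (sibling _)               = inj₁ refl
  ... | adj (swap _)                  = inj₂ refl
  ... | adj {p = s≤s (s≤s ())} child
  ... | adj parent                    = inj₁ refl
  neighbour-shares-block {_ ∷ _ ∷ _ ∷ _ , s≤s (s≤s ())} _ _

  CoversUnhit : Vertex C → (Vertex C → Label) → Set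
  CoversUnhit u f = ∀ ℓ → ¬ Hit ℓ → ∃ λ w → w ∈N[ u ] × Unseen w × f w ≡ ℓ

  seen-neighbourhood-or-covers : ∀ u → ¬ Unseen u →
    (∀ v → v ∈N[ u ] → ¬ Unseen v) ⊎ ∃ (CoversUnhit u)
  seen-neighbourhood-or-covers u@([] , _) ¬unseen with hit? zero
  ... | yes h0 = inj₁ λ v nb → carries-hit v h0 (neighbour-shares-block {u} (λ ()) nb)
  ... | no ¬h0 = ⊥-elim (¬unseen (¬h0 , ¬h0))
  seen-neighbourhood-or-covers (a ∷ [] , s≤s z≤n) ¬unseen with hit? zero | hit? (suc a)
  ... | yes h0  | yes ha  = inj₁ λ v nb → seen v (neighbour nb)
    where
      seen : ∀ v → Neighbour (vertex₁ a) v → ¬ Unseen v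
      seen v self              = carries-hit v ha (inj₁ refl)
      seen v (adj (sibling _)) = carries-hit v h0 (inj₂ refl)
      seen v (adj child)       = carries-hit v ha (inj₁ refl)
      seen v (adj parent)      = carries-hit v h0 (inj₁ refl)
  ... | yes h0  | no ¬ha  = inj₂ (digit , children)
    where
      children : CoversUnhit (vertex₁ a) digit
      children zero    ¬h0 = ⊥-elim (¬h0 h0)
      children (suc b) ¬hb = vertex₂ a b , adjacent child , (¬ha , ¬hb) , refl
  ... | no ¬h0  | yes ha  = inj₂ (block , apex-and-siblings)
    where
      apex-and-siblings : CoversUnhit (vertex₁ a) block
      apex-and-siblings zero    _   = apex , adjacent parent , (¬h0 , ¬h0) , refl
      apex-and-siblings (suc b) ¬hb =
        vertex₁ b , adjacent (sibling λ { refl → ¬hb ha }) , (¬hb , ¬h0) , refl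
  ... | no ¬h0  | no ¬ha  = ⊥-elim (¬unseen (¬ha , ¬h0))
  seen-neighbourhood-or-covers u@(x ∷ a ∷ [] , _) ¬unseen with hit? (suc a) | hit? (suc x)
  ... | yes ha | _      = inj₁ λ v nb → carries-hit v ha (neighbour-shares-block {u} (λ ()) nb)
  ... | no ¬ha | yes hx = inj₂ (digit , parent-and-siblings)
    where
      parent-and-siblings : CoversUnhit u digit
      parent-and-siblings zero    ¬h0 = vertex₁ a , adjacent parent , (¬ha , ¬h0) , refl
      parent-and-siblings (suc b) ¬hb =
        vertex₂ a b , adjacent (sibling λ { refl → ¬hb hx }) , (¬ha , ¬hb) , refl
  ... | no ¬ha | no ¬hx = ⊥-elim (¬unseen (¬ha , ¬hx))
  seen-neighbourhood-or-covers (_ ∷ _ ∷ _ ∷ _ , s≤s (s≤s ())) _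

  module _ (room : length S + k ≤ C) where

    too-few-labels : (f : Vertex C → Label) (xs : List (Vertex C)) → length xs ≤ k →
                     ¬ (∀ ℓ → ¬ Hit ℓ → ℓ ∈ map f xs)
    too-few-labels f xs |xs|≤k covers = 1+n≰n (begin
      suc C                                    ≤⟨ covering-length _ all-labels ⟩
      length (map block S ++ map f xs)         ≡⟨ length-++ (map block S) ⟩
      length (map block S) + length (map f xs) ≡⟨ cong₂ _+_ (length-map block S) (length-map f xs) ⟩
      length S + length xs                     ≤⟨ +-monoʳ-≤ (length S) |xs|≤k ⟩
      length S + k                             ≤⟨ room ⟩
      C                                        ∎)
      where
        open ≤-Reasoning
        all-labels : ∀ ℓ → ℓ ∈ map block S ++ map f xs
        all-labels ℓ with hit? ℓ
        ... | yes h  = ∈-++⁺ˡ h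
        ... | no ¬h  = ∈-++⁺ʳ (map block S) (covers ℓ ¬h)

    module _ (no-level₁ : ¬ Any (λ v → level v ≡ 1) S) where

      unseen-unobserved : ∀ i v → 𝒫 WKPAdj k S i v → ¬ Unseen v
      unseen-unobserved zero v (s , s∈S , nb) with level s ≟ 1
      ... | yes level₁ = ⊥-elim (no-level₁ (lose s∈S level₁))
      ... | no ¬level₁ = carries-hit v (∈-map⁺ block s∈S) (neighbour-shares-block ¬level₁ nb)
      unseen-unobserved (suc i) v (u , pu , (xs , |xs|≤k , forced) , nb)
        with seen-neighbourhood-or-covers u (unseen-unobserved i u pu)
      ... | inj₁ seen         = seen v nb
      ... | inj₂ (f , covers) = λ _ → too-few-labels f xs |xs|≤k λ ℓ ¬h →
        let w , nbw , unseen , fw≡ℓ = covers ℓ ¬h in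
        subst (_∈ map f xs) fw≡ℓ
              (∈-map⁺ f (forced w (nbw , λ pw → unseen-unobserved i w pw unseen)))

      diagonal : Label → Vertex C
      diagonal zero    = apex
      diagonal (suc a) = vertex₂ a a

      diagonal-unseen : ∀ ℓ → ¬ Hit ℓ → Unseen (diagonal ℓ)
      diagonal-unseen zero    ¬h = ¬h , ¬h
      diagonal-unseen (suc a) ¬h = ¬h , ¬h

      not-kpds : ¬ IsKPDS WKPAdj k S
      not-kpds kpds with any? (¬? ∘ hit?)
      ... | yes (ℓ , ¬h) = let i , observed = kpds (diagonal ℓ) in
        unseen-unobserved i (diagonal ℓ) observed (diagonal-unseen ℓ ¬h)
      ... | no all-hit   = too-few-labels block [] z≤n λ ℓ ¬h → ⊥-elim (all-hit (ℓ , ¬h))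

data Side (m n : ℕ) : Fin (m + n) → Set where
  left  : (i : Fin m) → Side m n (i ↑ˡ n)
  right : (j : Fin n) → Side m n (m ↑ʳ j)

side : ∀ m {n} (a : Fin (m + n)) → Side m n a
side m {n} a = subst (Side m n) (join-splitAt m n a) (side-of (splitAt m a))
  where
    side-of : (s : Fin m ⊎ Fin n) → Side m n (join m n s)
    side-of (inj₁ i) = left i
    side-of (inj₂ j) = right j

↑ˡ≢↑ʳ : ∀ {m n} (i : Fin m) (j : Fin n) → i ↑ˡ n ≢ m ↑ʳ j
↑ˡ≢↑ʳ {m} {n} i j eq
  with () ← trans (sym (splitAt-↑ˡ m i n)) (trans (cong (splitAt m) eq) (splitAt-↑ʳ m n j))

module UpperBound (m k : ℕ) (0<m : 0 < m) (1≤k : 1 ≤ k) where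

  T : List (Vertex (m + k))
  T = tabulate (λ i → vertex₁ (i ↑ˡ k))

  length-T : length T ≡ m
  length-T = length-tabulate _

  Observed : ℕ → Vertex (m + k) → Set
  Observed = 𝒫 WKPAdj k T

  open Forcing WKPAdj {k} {T}

  near-T : ∀ i {v} → v ∈N[ vertex₁ (i ↑ˡ k) ] → Observed 0 v
  near-T i nb = _ , ∈-tabulate⁺ i , nb

  a₀ : Fin (m + k)
  a₀ = fromℕ< 0<m ↑ˡ k

  apex-observed : Observed 0 apex
  apex-observed = near-T _ (adjacent {u = vertex₁ a₀} parent)

  level₁-observed : ∀ b → Observed 0 (vertex₁ b)
  level₁-observed b with a₀ ≟ᶠ b
  ... | yes refl  = near-T _ (inj₁ refl)
  ... | no a₀≢b   = near-T _ (adjacent {u = vertex₁ a₀} (sibling a₀≢b))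

  swap-observed : ∀ j i → Observed 1 (vertex₂ (m ↑ʳ j) (i ↑ˡ k))
  swap-observed j i = force 0 (near-T i (adjacent child)) [ vertex₂ (m ↑ʳ j) (i ↑ˡ k) ] 1≤k
    only-partner (adjacent (swap (≢-sym (↑ˡ≢↑ʳ i j))))
    where
      only-partner : ∀ w → w ∈N[ vertex₂ (i ↑ˡ k) (m ↑ʳ j) ] → ¬ Observed 0 w →
                     w ∈ [ vertex₂ (m ↑ʳ j) (i ↑ˡ k) ]
      only-partner w nb ¬obs with neighbour nb
      ... | self                                = ⊥-elim (¬obs (near-T i (adjacent child)))
      ... | adj {p = s≤s (s≤s z≤n)} (sibling _) = ⊥-elim (¬obs (near-T i (adjacent child)))
      ... | adj {p = s≤s (s≤s z≤n)} (swap _)    = here refl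
      ... | adj {p = s≤s (s≤s ())} child
      ... | adj {p = s≤s z≤n} parent            = ⊥-elim (¬obs (near-T i (inj₁ refl)))

  rest-observed : ∀ j' j → Observed 2 (vertex₂ (m ↑ʳ j') (m ↑ʳ j))
  rest-observed j' j = force 1 (𝒫-suc 0 (level₁-observed a))
    (tabulate (λ j → vertex₂ a (m ↑ʳ j))) (≤-reflexive (length-tabulate _))
    only-outer-children (adjacent child)
    where
      a = m ↑ʳ j'
      only-outer-children : ∀ w → w ∈N[ vertex₁ a ] → ¬ Observed 1 w →
                            w ∈ tabulate (λ j → vertex₂ a (m ↑ʳ j))
      only-outer-children w nb ¬obs with neighbour nb
      ... | self                                  = ⊥-elim (¬obs (𝒫-suc 0 (level₁-observed a)))
      ... | adj {p = s≤s z≤n} (sibling {b = b} _) = ⊥-elim (¬obs (𝒫-suc 0 (level₁-observed b)))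
      ... | adj {p = z≤n} parent                  = ⊥-elim (¬obs (𝒫-suc 0 apex-observed))
      ... | adj {p = s≤s (s≤s z≤n)} (child {b = y}) with side m y
      ...   | left i  = ⊥-elim (¬obs (swap-observed j' i))
      ...   | right j = ∈-tabulate⁺ j

  level₂-observed : ∀ a x → ∃ λ i → Observed i (vertex₂ a x)
  level₂-observed a x with side m a | side m x
  ... | left i   | _        = 0 , near-T i (adjacent child)
  ... | right j' | left i   = 1 , swap-observed j' i
  ... | right j' | right j  = 2 , rest-observed j' j

  kpds : IsKPDS WKPAdj k T
  kpds ([] , z≤n)                   = 0 , apex-observed
  kpds (a ∷ [] , s≤s z≤n)           = 0 , level₁-observed a
  kpds (x ∷ a ∷ [] , s≤s (s≤s z≤n)) = level₂-observed a x
  kpds (_ ∷ _ ∷ _ ∷ _ , s≤s (s≤s ()))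

small-kpds : ∀ {C} k → 1 ≤ k → k < C →
             ∃ λ (T : List (Vertex C)) → IsKPDS WKPAdj k T × length T ≡ C ∸ k
small-kpds {C} k 1≤k k<C =
  subst (λ n → ∃ λ (T : List (Vertex n)) → IsKPDS WKPAdj k T × length T ≡ C ∸ k)
        (m∸n+n≡m (<⇒≤ k<C))
        (T , kpds , length-T)
  where open UpperBound (C ∸ k) k (m<n⇒0<n∸m k<C) 1≤k

mainTheorem9 : (C k : ℕ) → 3 ≤ C → 1 ≤ k → k ≤ C ∸ 1 →
    (S : List (WKPVertex C 2)) → Unique S →
    IsMinKPDS (WKPAdj {C} {2}) k S →
    ∃ λ v → v ∈ S × level v ≡ 1
mainTheorem9 (suc c) k (s≤s _) 1≤k k≤c S _ (kpds , minimal)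
  with Any.any? (λ v → level v ≟ 1) S | small-kpds k 1≤k (s≤s k≤c)
... | yes level₁   | _               = find level₁
... | no no-level₁ | T , T-kpds , |T| = ⊥-elim (LowerBound.not-kpds k S room no-level₁ kpds)
  where
    open ≤-Reasoning
    room : length S + k ≤ suc c
    room = begin
      length S + k      ≤⟨ +-monoˡ-≤ k (minimal T T-kpds) ⟩
      length T + k      ≡⟨ cong (_+ k) |T| ⟩
      suc c ∸ k + k     ≡⟨ m∸n+n≡m (<⇒≤ (s≤s k≤c)) ⟩
      suc c             ∎
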